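{- If two descendant chains have the same ordered octuple of neighbourhood vectors $(\mathbf{s}_1,\dots,\mathbf{s}_8)$, then their proto-descents coincide modulo $f$-commutativity. In particular, the proto-descent of a descendant chain is determined uniquely, modulo $f$-commutativity, by the ordered octuple of its neighbourhood vectors.
   Context: Words are over $\mathcal{A}_\square=\{\mathsf{R},\mathsf{L},\mathsf{U},\mathsf{D}\}$ with reversal $\mathsf{R}\leftrightarrow\mathsf{L}$, $\mathsf{U}\leftrightarrow\mathsf{D}$. A word chain is a cyclic sequence $U_1:\cdots:U_8$ of words, indices modulo $8$. Lifts. For $V=\varphi(U)$: - $f_i$, for $i=1,\dots,4$: $V_j=U_j$ for $j\not\equiv i\pmod 4$, and $V_j=(U_{j+3}U_{j+4}U_{j+5})^{ -1}$ for $j\equiv i\pmod 4$. - $g^\star_{\mathrm{odd}}$: $V_i=(U_{i-2}\cdots U_{i+2})^{ -1}$ for odd $i$, and $V_i=U_{i+3}U_{i+4}U_{i+5}$ for even $i$. - $g^\star_{\mathrm{even}}$: "odd" and "even" swapped. Descents. A descent of $U$ is a sequence $(\varphi_1,\dots,\varphi_k)$ of these six maps with $U=\varphi_k\circ\cdots\circ\varphi_1$ applied to the Greek cross $\mathsf{R}:\mathsf{U}\mathsf{R}:\mathsf{U}:\mathsf{L}\mathsf{U}:\mathsf{L}:\mathsf{D}\mathsf{L}:\mathsf{D}:\mathsf{R}\mathsf{D}$. Descendant chains are chains admitting a descent. A proto-descent of $U$ is obtained from a descent of $U$ by replacing every occurrence of $g^\star_{\mathrm{odd}}$ and of $g^\star_{\mathrm{even}}$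 by one common symbol $g^\star$. Two such sequences are equal modulo $f$-commutativity if one is obtained from the other by repeatedly swapping adjacent $f_1,f_3$ or adjacent $f_2,f_4$. Vectors. The span of a word $W$ is $(\#\mathsf{R}-\#\mathsf{L},\ \#\mathsf{U}-\#\mathsf{D})$, counting letters in $W$. The neighbourhood vectors of $U$ are $\mathbf{s}_i=$ span of $U_iU_{i+1}$, for $i=1,\dots,8$. -}

module Defs where

open import Data.Nat using (ℕ; zero; suc; _+_)
open import Data.Nat.DivMod using (_mod_; _%_)
open import Data.Nat.Properties using (_≟_)
open import Data.Fin using (Fin; toℕ) renaming (zero to fz; suc to fs)
open import Data.Integer as ℤ using (ℤ)
open import Data.Product using (_×_; _,_)
open import Data.List using (List; []; _∷_; _++_; reverse; map; foldl)
open import Data.Vec using (Vec; lookup; tabulate) renaming (_∷_ to _∷v_; [] to []v)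
open import Relation.Nullary using (does)
open import Relation.Binary.PropositionalEquality using (_≡_)
open import Data.Bool using (Bool; if_then_else_)
open import Relation.Binary.Construct.Closure.ReflexiveTransitive using (Star)

data Letter : Set where
  R L U D : Letter

rev : Letter → Letter
rev R = L
rev L = R
rev U = D
rev D = U

Word : Set
Word = List Letter

inv : Word → Word
inv w = reverse (map rev w)

-- A word chain U_1 : ... : U_8, stored 0-based: position k ∈ Fin 8 is U_{k+1}
Chain : Set
Chain = Vec Word 8

sh : Fin 8 → ℕ → Fin 8
sh j k = (toℕ j + k) mod 8

at : Chain → Fin 8 → ℕ → Word
at C j k = lookup C (sh j k)

-- The six lifts. f i with i : Fin 4 is the paper's f_{i+1}.
data Lift : Set where
  f     : Fin 4 → Lift
  godd  : Lift
  geven : Lift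

-- paper index j (1-based) is odd iff the 0-based index toℕ j is even
paperOdd : Fin 8 → Bool
paperOdd j = does ((toℕ j % 2) ≟ 0)

three : Chain → Fin 8 → Word
three C j = at C j 3 ++ at C j 4 ++ at C j 5

-- U_{j-2} ... U_{j+2}  (j-2 ≡ j+6, j-1 ≡ j+7 mod 8)
five : Chain → Fin 8 → Word
five C j = at C j 6 ++ at C j 7 ++ at C j 0 ++ at C j 1 ++ at C j 2

apply : Lift → Chain → Chain
apply (f i) C = tabulate λ j →
  if does ((toℕ j % 4) ≟ toℕ i) then inv (three C j) else lookup C j
apply godd C = tabulate λ j →
  if paperOdd j then inv (five C j) else three C j
apply geven C = tabulate λ j →
  if paperOdd j then three C j else inv (five C j)

greekCross : Chain
greekCross = (R ∷ []) ∷v (U ∷ R ∷ []) ∷v (U ∷ []) ∷v (L ∷ U ∷ [])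
  ∷v (L ∷ []) ∷v (D ∷ L ∷ []) ∷v (D ∷ []) ∷v (R ∷ D ∷ []) ∷v []v

run : List Lift → Chain
run ds = foldl (λ C φ → apply φ C) greekCross ds

IsDescent : List Lift → Chain → Set
IsDescent ds C = run ds ≡ C

data PLift : Set where
  pf : Fin 4 → PLift
  pg : PLift

protoSym : Lift → PLift
protoSym (f i) = pf i
protoSym godd  = pg
protoSym geven = pg

proto : List Lift → List PLift
proto = map protoSym

data Commute : PLift → PLift → Set where
  c13 : Commute (pf fz) (pf (fs (fs fz)))
  c31 : Commute (pf (fs (fs fz))) (pf fz)
  c24 : Commute (pf (fs fz)) (pf (fs (fs (fs fz))))
  c42 : Commute (pf (fs (fs (fs fz)))) (pf (fs fz))

data Swap : List PLift → List PLift → Set where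
  here  : ∀ {a b xs} → Commute a b → Swap (a ∷ b ∷ xs) (b ∷ a ∷ xs)
  there : ∀ {x xs ys} → Swap xs ys → Swap (x ∷ xs) (x ∷ ys)

-- equality modulo f-commutativity (Swap is symmetric, so Star is an equivalence)
_≈f_ : List PLift → List PLift → Set
_≈f_ = Star Swap

span : Word → ℤ × ℤ
span [] = ℤ.0ℤ , ℤ.0ℤ
span (R ∷ w) with span w
... | (x , y) = x ℤ.+ ℤ.1ℤ , y
span (L ∷ w) with span w
... | (x , y) = x ℤ.- ℤ.1ℤ , y
span (U ∷ w) with span w
... | (x , y) = x , y ℤ.+ ℤ.1ℤ
span (D ∷ w) with span w
... | (x , y) = x , y ℤ.- ℤ.1ℤ

nv : Chain → Fin 8 → ℤ × ℤ
nv C i = span (at C i 0 ++ at C i 1)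

-- The spans of the eight words of a chain reachable from the Greek cross satisfy
-- span U₍ᵢ₊₄₎ = − span Uᵢ, so such a chain is seen through the quadruple (u₁, …, u₄) of the
-- spans of U₁ … U₄, on which every lift acts linearly, g⋆odd and g⋆even alike.  Descents keep
-- the quadruple convex (all six det(uᵢ, uⱼ), i < j, positive), the Greek cross has no convex
-- predecessor, and two different inverse lifts both yielding convex quadruples are either f₁, f₃
-- or f₂, f₄, which commute and (by the Plücker relation) compose to a convex quadruple again, or
-- impossible, because a sum of determinants that would all be positive vanishes identically.
-- Peeling lifts off the end, the quadruple therefore determines the proto-descent modulo
-- f-commutativity.  Finally the quadruple is recovered from the neighbourhood vectors: with
-- sᵢ = uᵢ + uᵢ₊₁ and u₅ = − u₁ one gets 2u₁ = s₁ − s₂ + s₃ − s₄, and similarly for u₂, u₃, u₄.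

module Submission where

open import Defs
open import Data.Bool using (true; false; if_then_else_)
open import Data.Empty using (⊥; ⊥-elim)
open import Data.Fin using (Fin; zero; suc; toℕ; #_)
open import Data.Integer as ℤ using (ℤ; +_; 0ℤ; 1ℤ; _<_)
import Data.Integer.Properties as ℤ
open import Data.Integer.Solver using (module +-*-Solver)
open import Data.List using (List; []; _∷_; _++_; _∷ʳ_; foldl; map)
open import Data.List.Properties using (foldl-∷ʳ; unfold-reverse)
open import Data.List.Reverse using (Reverse; reverseView; []; _∶_∶ʳ_)
open import Data.Nat using (ℕ)
open import Data.Nat.DivMod using (_%_)
open import Data.Nat.Properties using (_≟_)
open import Data.Product using (_×_; _,_; proj₁; proj₂; ∃-syntax)
open import Data.Product.Properties using (×-≡,≡→≡; ×-≡,≡←≡)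
open import Data.Sum using (_⊎_; inj₁; inj₂)
open import Data.Vec as Vec using (Vec; []; _∷_; lookup; tabulate)
open import Data.Vec.Properties using (lookup-map; tabulate-∘; tabulate-cong; ∷-injective)
open import Data.Vec.Relation.Unary.All using (All; []; _∷_; all?)
open import Function using (_∘_)
import Relation.Binary.Construct.Closure.ReflexiveTransitive as Star
open Star using (ε; _◅_; _◅◅_)
open import Relation.Binary.PropositionalEquality
  using (_≡_; _≢_; refl; sym; trans; cong; cong₂; subst; module ≡-Reasoning)
open import Relation.Nullary using (¬_; Dec; does)
open import Relation.Nullary.Decidable using (from-yes; from-no)
open +-*-Solver using (Polynomial; var; con; _:+_; _:*_; :-_; ⟦_⟧; ⟦_⟧↓; prove)

-- Polynomial identities in plane vectors

record RingOperations (A : Set) : Set where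
  infixl 6 _+_
  infixl 7 _*_
  infix 8 -_
  field
    0#      : A
    _+_ _*_ : A → A → A
    -_      : A → A

open RingOperations ⦃ … ⦄

instance
  ℤ-operations : RingOperations ℤ
  ℤ-operations = record { 0# = 0ℤ ; _+_ = ℤ._+_ ; _*_ = ℤ._*_ ; -_ = ℤ.-_ }

  polynomial-operations : ∀ {n} → RingOperations (Polynomial n)
  polynomial-operations = record { 0# = con 0ℤ ; _+_ = _:+_ ; _*_ = _:*_ ; -_ = :-_ }

Vector : Set → Set
Vector A = A × A

Quadruple : Set → Set
Quadruple A = Vector A × Vector A × Vector A × Vector A

module _ {A : Set} ⦃ _ : RingOperations A ⦄ where

  infixl 6 _⊕_ _⊖_
  infix 8 ⊖_

  _⊕_ : Vector A → Vector A → Vector A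
  (x , y) ⊕ (x′ , y′) = x + x′ , y + y′

  ⊖_ : Vector A → Vector A
  ⊖ (x , y) = - x , - y

  _⊖_ : Vector A → Vector A → Vector A
  u ⊖ v = u ⊕ ⊖ v

  det : Vector A → Vector A → A
  det (x , y) (x′ , y′) = x * y′ + - (y * x′)

data Shape : Set where
  scalar : Shape
  _⊗_    : Shape → Shape → Shape
  vector : ℕ → Shape → Shape

⟨_⟩ : Shape → Set → Set
⟨ scalar ⟩     A = A
⟨ σ ⊗ τ ⟩      A = ⟨ σ ⟩ A × ⟨ τ ⟩ A
⟨ vector n σ ⟩ A = Vec (⟨ σ ⟩ A) n

plane quadruple : Shape
plane     = scalar ⊗ scalar
quadruple = plane ⊗ (plane ⊗ (plane ⊗ plane))

evaluate : (Polynomial 8 → Vec ℤ 8 → ℤ) → ∀ σ → ⟨ σ ⟩ (Polynomial 8) → Vec ℤ 8 → ⟨ σ ⟩ ℤ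
evaluate ⟦·⟧ scalar       p        ρ = ⟦·⟧ p ρ
evaluate ⟦·⟧ (σ ⊗ τ)      (p , q)  ρ = evaluate ⟦·⟧ σ p ρ , evaluate ⟦·⟧ τ q ρ
evaluate ⟦·⟧ (vector _ σ) []       ρ = []
evaluate ⟦·⟧ (vector _ σ) (p ∷ ps) ρ = evaluate ⟦·⟧ σ p ρ ∷ evaluate ⟦·⟧ (vector _ σ) ps ρ

evaluate-normalised : ∀ σ (p q : ⟨ σ ⟩ (Polynomial 8)) ρ →
  evaluate ⟦_⟧↓ σ p ρ ≡ evaluate ⟦_⟧↓ σ q ρ → evaluate ⟦_⟧ σ p ρ ≡ evaluate ⟦_⟧ σ q ρ
evaluate-normalised scalar p q ρ = prove ρ p q
evaluate-normalised (σ ⊗ τ) (p , p′) (q , q′) ρ e =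
  let e₁ , e₂ = ×-≡,≡←≡ e
  in  cong₂ _,_ (evaluate-normalised σ p q ρ e₁) (evaluate-normalised τ p′ q′ ρ e₂)
evaluate-normalised (vector _ σ) [] [] ρ e = refl
evaluate-normalised (vector _ σ) (p ∷ ps) (q ∷ qs) ρ e =
  let e₁ , e₂ = ∷-injective e
  in  cong₂ _∷_ (evaluate-normalised σ p q ρ e₁) (evaluate-normalised (vector _ σ) ps qs ρ e₂)

symbolic : Quadruple (Polynomial 8)
symbolic = (var (# 0) , var (# 1)) , (var (# 2) , var (# 3)) ,
           (var (# 4) , var (# 5)) , (var (# 6) , var (# 7))

coordinates : Quadruple ℤ → Vec ℤ 8
coordinates ((x₁ , y₁) , (x₂ , y₂) , (x₃ , y₃) , (x₄ , y₄)) =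
  x₁ ∷ y₁ ∷ x₂ ∷ y₂ ∷ x₃ ∷ y₃ ∷ x₄ ∷ y₄ ∷ []

Expression : Shape → Set₁
Expression σ = ∀ {A} ⦃ _ : RingOperations A ⦄ → Quadruple A → ⟨ σ ⟩ A

-- Identity σ F G: F s ≡ G s for all integer quadruples s.  by-normalisation obtains it from the
-- ring solver's normal forms of F symbolic and G symbolic; its hypothesis bundles that comparison
-- with the facts that F s and G s are F symbolic and G symbolic evaluated at the coordinates of s,
-- all of which hold by computation, so  by-normalisation refl  proves any true identity.
record Identity σ (F G : Expression σ) : Set where
  field
    _on_ : ∀ s → F {ℤ} s ≡ G s

open Identity public

by-normalisation : ∀ {σ} {F G : Expression σ} →
  (λ s ρ → F {ℤ} s , G {ℤ} s , evaluate ⟦_⟧↓ σ (F symbolic) ρ) ≡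
  (λ s ρ → evaluate ⟦_⟧ σ (F symbolic) (coordinates s) , evaluate ⟦_⟧ σ (G symbolic) (coordinates s) ,
           evaluate ⟦_⟧↓ σ (G symbolic) ρ) →
  Identity σ F G
by-normalisation {σ} {F} {G} computation = record { _on_ = agree }
  where
  agree : ∀ s → F {ℤ} s ≡ G s
  agree s =
    let F-evaluates , rest = ×-≡,≡←≡ (cong (λ h → h s (coordinates s)) computation)
        G-evaluates , normal-forms-agree = ×-≡,≡←≡ rest
    in  trans F-evaluates
          (trans (evaluate-normalised σ (F symbolic) (G symbolic) (coordinates s) normal-forms-agree)
                 (sym G-evaluates))

plücker : Identity scalar (λ (p , q , r , t) → det p q * det r t)
                         (λ (p , q , r , t) → det p r * det q t + det p t * det r q)
plücker = by-normalisation refl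

infixl 6 _+ᵖ_

_+ᵖ_ : ∀ {a b : ℤ} → 0ℤ < a → 0ℤ < b → 0ℤ < a ℤ.+ b
_+ᵖ_ = ℤ.+-mono-<

positive-* : ∀ {a b : ℤ} → 0ℤ < a → 0ℤ < b → 0ℤ < a ℤ.* b
positive-* {b = b} a>0 b>0 = ℤ.*-monoʳ-<-pos b ⦃ ℤ.positive b>0 ⦄ a>0

positive-factorʳ : ∀ {a b : ℤ} → 0ℤ < b → 0ℤ < a ℤ.* b → 0ℤ < a
positive-factorʳ {b = b} b>0 = ℤ.*-cancelʳ-<-nonNeg b ⦃ ℤ.nonNegative (ℤ.<⇒≤ b>0) ⦄

positive-factorˡ : ∀ {a b : ℤ} → 0ℤ < a → 0ℤ < a ℤ.* b → 0ℤ < b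
positive-factorˡ {a} {b} a>0 ab>0 = positive-factorʳ a>0 (subst (0ℤ <_) (ℤ.*-comm a b) ab>0)

positive-sum-nonzero : ∀ {a b c : ℤ} → 0ℤ < a → 0ℤ < b → 0ℤ < c → a ℤ.+ b ℤ.+ c ≢ 0ℤ
positive-sum-nonzero a>0 b>0 c>0 e = ℤ.<-irrefl (sym e) (a>0 +ᵖ b>0 +ᵖ c>0)

plücker-positive : ∀ p q r t → 0ℤ < det p r → 0ℤ < det q t → 0ℤ < det p t → 0ℤ < det r q →
  0ℤ < det p q ℤ.* det r t
plücker-positive p q r t pr qt pt rq =
  subst (0ℤ <_) (sym (plücker on (p , q , r , t))) (positive-* pr qt +ᵖ positive-* pt rq)

-- Lifts acting on quadruples of spans

pattern f₁ = pf zero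
pattern f₂ = pf (suc zero)
pattern f₃ = pf (suc (suc zero))
pattern f₄ = pf (suc (suc (suc zero)))
pattern g⋆ = pg

module _ {A : Set} ⦃ _ : RingOperations A ⦄ where

  -- (u₁ , u₂ , u₃ , u₄) stands for the spans of U₁ … U₄, those of U₅ … U₈ being their
  -- negatives; so cyclically u₀ = ⊖ u₄ and u₅ = ⊖ u₁, and then
  -- σᵢ = u₍ᵢ₋₁₎ ⊕ uᵢ ⊕ u₍ᵢ₊₁₎ and δᵢ = uᵢ ⊖ u₍ᵢ₋₁₎ ⊖ u₍ᵢ₊₁₎.
  σ₁ σ₂ σ₃ σ₄ δ₁ δ₂ δ₃ δ₄ : Quadruple A → Vector A
  σ₁ (u₁ , u₂ , u₃ , u₄) = u₁ ⊕ u₂ ⊖ u₄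
  σ₂ (u₁ , u₂ , u₃ , u₄) = u₁ ⊕ u₂ ⊕ u₃
  σ₃ (u₁ , u₂ , u₃ , u₄) = u₂ ⊕ u₃ ⊕ u₄
  σ₄ (u₁ , u₂ , u₃ , u₄) = u₃ ⊕ u₄ ⊖ u₁
  δ₁ (u₁ , u₂ , u₃ , u₄) = u₁ ⊕ u₄ ⊖ u₂
  δ₂ (u₁ , u₂ , u₃ , u₄) = u₂ ⊖ u₁ ⊖ u₃
  δ₃ (u₁ , u₂ , u₃ , u₄) = u₃ ⊖ u₂ ⊖ u₄
  δ₄ (u₁ , u₂ , u₃ , u₄) = u₄ ⊖ u₃ ⊕ u₁

  step unstep : PLift → Quadruple A → Quadruple A
  step f₁ s@(_  , u₂ , u₃ , u₄) = σ₁ s , u₂ , u₃ , u₄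
  step f₂ s@(u₁ , _  , u₃ , u₄) = u₁ , σ₂ s , u₃ , u₄
  step f₃ s@(u₁ , u₂ , _  , u₄) = u₁ , u₂ , σ₃ s , u₄
  step f₄ s@(u₁ , u₂ , u₃ , _ ) = u₁ , u₂ , u₃ , σ₄ s
  step g⋆ s                    = ⊖ σ₁ s , ⊖ σ₂ s , ⊖ σ₃ s , ⊖ σ₄ s
  unstep f₁ s@(_  , u₂ , u₃ , u₄) = δ₁ s , u₂ , u₃ , u₄
  unstep f₂ s@(u₁ , _  , u₃ , u₄) = u₁ , δ₂ s , u₃ , u₄
  unstep f₃ s@(u₁ , u₂ , _  , u₄) = u₁ , u₂ , δ₃ s , u₄
  unstep f₄ s@(u₁ , u₂ , u₃ , _ ) = u₁ , u₂ , u₃ , δ₄ s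
  unstep g⋆ s                    = δ₁ s , δ₂ s , δ₃ s , δ₄ s

  dets : Quadruple A → Vec A 6
  dets (u₁ , u₂ , u₃ , u₄) = det u₁ u₂ ∷ det u₁ u₃ ∷ det u₁ u₄ ∷ det u₂ u₃ ∷ det u₂ u₄ ∷ det u₃ u₄ ∷ []

unstep-step : ∀ φ → Identity quadruple (λ s → unstep φ (step φ s)) (λ s → s)
unstep-step f₁ = by-normalisation refl
unstep-step f₂ = by-normalisation refl
unstep-step f₃ = by-normalisation refl
unstep-step f₄ = by-normalisation refl
unstep-step g⋆ = by-normalisation refl

step-injective : ∀ φ {s t} → step φ s ≡ step φ t → s ≡ t
step-injective φ {s} {t} e = trans (sym (unstep-step φ on s)) (trans (cong (unstep φ) e) (unstep-step φ on t))

step-commute : ∀ {φ ψ} → Commute φ ψ → ∀ (s : Quadruple ℤ) → step ψ (step φ s) ≡ step φ (step ψ s)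
step-commute c13 s = refl
step-commute c31 s = refl
step-commute c24 s = refl
step-commute c42 s = refl

-- u₁, u₂, u₃, u₄, ⊖ u₁ lie in strictly counterclockwise order within a half-turn.
Convex : Quadruple ℤ → Set
Convex s = All (0ℤ <_) (dets s)

convex? : ∀ s → Dec (Convex s)
convex? s = all? (0ℤ ℤ.<?_) (dets s)

dets-step-f₁ : Identity (vector 6 scalar) (λ s → dets (step f₁ s)) λ (u₁ , u₂ , u₃ , u₄) →
    det u₁ u₂ + det u₂ u₄ ∷ det u₁ u₃ + det u₂ u₃ + det u₃ u₄ ∷ det u₁ u₄ + det u₂ u₄ ∷
    det u₂ u₃ ∷ det u₂ u₄ ∷ det u₃ u₄ ∷ []
dets-step-f₁ = by-normalisation refl

dets-step-f₂ : Identity (vector 6 scalar) (λ s → dets (step f₂ s)) λ (u₁ , u₂ , u₃ , u₄) →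
    det u₁ u₂ + det u₁ u₃ ∷ det u₁ u₃ ∷ det u₁ u₄ ∷ det u₁ u₃ + det u₂ u₃ ∷
    det u₁ u₄ + det u₂ u₄ + det u₃ u₄ ∷ det u₃ u₄ ∷ []
dets-step-f₂ = by-normalisation refl

dets-step-f₃ : Identity (vector 6 scalar) (λ s → dets (step f₃ s)) λ (u₁ , u₂ , u₃ , u₄) →
    det u₁ u₂ ∷ det u₁ u₂ + det u₁ u₃ + det u₁ u₄ ∷ det u₁ u₄ ∷ det u₂ u₃ + det u₂ u₄ ∷
    det u₂ u₄ ∷ det u₂ u₄ + det u₃ u₄ ∷ []
dets-step-f₃ = by-normalisation refl

dets-step-f₄ : Identity (vector 6 scalar) (λ s → dets (step f₄ s)) λ (u₁ , u₂ , u₃ , u₄) →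
    det u₁ u₂ ∷ det u₁ u₃ ∷ det u₁ u₃ + det u₁ u₄ ∷ det u₂ u₃ ∷
    det u₁ u₂ + det u₂ u₃ + det u₂ u₄ ∷ det u₁ u₃ + det u₃ u₄ ∷ []
dets-step-f₄ = by-normalisation refl

dets-step-g⋆ : Identity (vector 6 scalar) (λ s → dets (step g⋆ s)) λ (u₁ , u₂ , u₃ , u₄) →
      det u₁ u₃ + det u₁ u₄ + det u₂ u₃ + det u₂ u₄ + det u₃ u₄
    ∷ det u₁ u₂ + det u₁ u₃ + det u₁ u₄ + det u₂ u₃ + det u₂ u₄ + det u₂ u₄ + det u₃ u₄
    ∷ det u₁ u₂ + det u₁ u₃ + det u₂ u₃ + det u₂ u₄ + det u₃ u₄
    ∷ det u₁ u₂ + det u₁ u₃ + det u₁ u₄ + det u₂ u₄ + det u₃ u₄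
    ∷ det u₁ u₂ + det u₁ u₃ + det u₁ u₃ + det u₁ u₄ + det u₂ u₃ + det u₂ u₄ + det u₃ u₄
    ∷ det u₁ u₂ + det u₁ u₃ + det u₁ u₄ + det u₂ u₃ + det u₂ u₄
    ∷ []
dets-step-g⋆ = by-normalisation refl

step-convex : ∀ φ s → Convex s → Convex (step φ s)
step-convex f₁ s (p₁₂ ∷ p₁₃ ∷ p₁₄ ∷ p₂₃ ∷ p₂₄ ∷ p₃₄ ∷ []) =
  subst (All (0ℤ <_)) (sym (dets-step-f₁ on s))
    (p₁₂ +ᵖ p₂₄ ∷ p₁₃ +ᵖ p₂₃ +ᵖ p₃₄ ∷ p₁₄ +ᵖ p₂₄ ∷ p₂₃ ∷ p₂₄ ∷ p₃₄ ∷ [])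
step-convex f₂ s (p₁₂ ∷ p₁₃ ∷ p₁₄ ∷ p₂₃ ∷ p₂₄ ∷ p₃₄ ∷ []) =
  subst (All (0ℤ <_)) (sym (dets-step-f₂ on s))
    (p₁₂ +ᵖ p₁₃ ∷ p₁₃ ∷ p₁₄ ∷ p₁₃ +ᵖ p₂₃ ∷ p₁₄ +ᵖ p₂₄ +ᵖ p₃₄ ∷ p₃₄ ∷ [])
step-convex f₃ s (p₁₂ ∷ p₁₃ ∷ p₁₄ ∷ p₂₃ ∷ p₂₄ ∷ p₃₄ ∷ []) =
  subst (All (0ℤ <_)) (sym (dets-step-f₃ on s))
    (p₁₂ ∷ p₁₂ +ᵖ p₁₃ +ᵖ p₁₄ ∷ p₁₄ ∷ p₂₃ +ᵖ p₂₄ ∷ p₂₄ ∷ p₂₄ +ᵖ p₃₄ ∷ [])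
step-convex f₄ s (p₁₂ ∷ p₁₃ ∷ p₁₄ ∷ p₂₃ ∷ p₂₄ ∷ p₃₄ ∷ []) =
  subst (All (0ℤ <_)) (sym (dets-step-f₄ on s))
    (p₁₂ ∷ p₁₃ ∷ p₁₃ +ᵖ p₁₄ ∷ p₂₃ ∷ p₁₂ +ᵖ p₂₃ +ᵖ p₂₄ ∷ p₁₃ +ᵖ p₃₄ ∷ [])
step-convex g⋆ s (p₁₂ ∷ p₁₃ ∷ p₁₄ ∷ p₂₃ ∷ p₂₄ ∷ p₃₄ ∷ []) =
  subst (All (0ℤ <_)) (sym (dets-step-g⋆ on s))
    ( p₁₃ +ᵖ p₁₄ +ᵖ p₂₃ +ᵖ p₂₄ +ᵖ p₃₄
    ∷ p₁₂ +ᵖ p₁₃ +ᵖ p₁₄ +ᵖ p₂₃ +ᵖ p₂₄ +ᵖ p₂₄ +ᵖ p₃₄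
    ∷ p₁₂ +ᵖ p₁₃ +ᵖ p₂₃ +ᵖ p₂₄ +ᵖ p₃₄
    ∷ p₁₂ +ᵖ p₁₃ +ᵖ p₁₄ +ᵖ p₂₄ +ᵖ p₃₄
    ∷ p₁₂ +ᵖ p₁₃ +ᵖ p₁₃ +ᵖ p₁₄ +ᵖ p₂₃ +ᵖ p₂₄ +ᵖ p₃₄
    ∷ p₁₂ +ᵖ p₁₃ +ᵖ p₁₄ +ᵖ p₂₃ +ᵖ p₂₄
    ∷ [])

-- At most one last lift, up to f-commutativity

Incompatible : PLift → PLift → Set
Incompatible φ ψ = ∀ s → Convex s → Convex (unstep φ s) → Convex (unstep ψ s) → ⊥

f₁-f₂-incompatible : Incompatible f₁ f₂
f₁-f₂-incompatible s (_ ∷ _ ∷ _ ∷ _ ∷ _ ∷ p₃₄ ∷ []) (_ ∷ p ∷ _) (_ ∷ _ ∷ _ ∷ q ∷ _) =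
  positive-sum-nonzero p₃₄ p q (cancellation on s)
  where
  cancellation : Identity scalar (λ s@(u₁ , u₂ , u₃ , u₄) →
    det u₃ u₄ + det (δ₁ s) u₃ + det (δ₂ s) u₃) λ _ → 0#
  cancellation = by-normalisation refl

f₂-f₃-incompatible : Incompatible f₂ f₃
f₂-f₃-incompatible s (_ ∷ _ ∷ p₁₄ ∷ _) (p ∷ _) (_ ∷ q ∷ _) =
  positive-sum-nonzero p₁₄ p q (cancellation on s)
  where
  cancellation : Identity scalar (λ s@(u₁ , u₂ , u₃ , u₄) →
    det u₁ u₄ + det u₁ (δ₂ s) + det u₁ (δ₃ s)) λ _ → 0#
  cancellation = by-normalisation refl

f₃-f₄-incompatible : Incompatible f₃ f₄
f₃-f₄-incompatible s (p₁₂ ∷ _) (_ ∷ p ∷ _) (_ ∷ _ ∷ q ∷ _) =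
  positive-sum-nonzero p₁₂ p q (cancellation on s)
  where
  cancellation : Identity scalar (λ s@(u₁ , u₂ , u₃ , u₄) →
    det u₁ u₂ + det u₁ (δ₃ s) + det u₁ (δ₄ s)) λ _ → 0#
  cancellation = by-normalisation refl

f₁-f₄-incompatible : Incompatible f₁ f₄
f₁-f₄-incompatible s (_ ∷ _ ∷ _ ∷ p₂₃ ∷ _) (p ∷ _) (_ ∷ _ ∷ _ ∷ _ ∷ q ∷ _) =
  positive-sum-nonzero p₂₃ p q (cancellation on s)
  where
  cancellation : Identity scalar (λ s@(u₁ , u₂ , u₃ , u₄) →
    det u₂ u₃ + det (δ₁ s) u₂ + det u₂ (δ₄ s)) λ _ → 0#
  cancellation = by-normalisation refl

f₁-g⋆-incompatible : Incompatible f₁ g⋆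
f₁-g⋆-incompatible s _ (p ∷ _) (q ∷ r ∷ _) = positive-sum-nonzero p q r (cancellation on s)
  where
  cancellation : Identity scalar (λ s@(u₁ , u₂ , u₃ , u₄) →
    det (δ₁ s) u₂ + det (δ₁ s) (δ₂ s) + det (δ₁ s) (δ₃ s)) λ _ → 0#
  cancellation = by-normalisation refl

f₂-g⋆-incompatible : Incompatible f₂ g⋆
f₂-g⋆-incompatible s _ (_ ∷ _ ∷ _ ∷ _ ∷ p ∷ _) (q ∷ _ ∷ _ ∷ r ∷ t ∷ _) =
  positive-sum-nonzero (p +ᵖ q) r t (cancellation on s)
  where
  cancellation : Identity scalar (λ s@(u₁ , u₂ , u₃ , u₄) →
    det (δ₂ s) u₄ + det (δ₁ s) (δ₂ s) + det (δ₂ s) (δ₃ s) + det (δ₂ s) (δ₄ s)) λ _ → 0#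
  cancellation = by-normalisation refl

f₃-g⋆-incompatible : Incompatible f₃ g⋆
f₃-g⋆-incompatible s _ (_ ∷ _ ∷ _ ∷ p ∷ _) (_ ∷ q ∷ _ ∷ r ∷ _) = positive-sum-nonzero p q r (cancellation on s)
  where
  cancellation : Identity scalar (λ s@(u₁ , u₂ , u₃ , u₄) →
    det u₂ (δ₃ s) + det (δ₁ s) (δ₃ s) + det (δ₂ s) (δ₃ s)) λ _ → 0#
  cancellation = by-normalisation refl

f₄-g⋆-incompatible : Incompatible f₄ g⋆
f₄-g⋆-incompatible s _ (_ ∷ _ ∷ p ∷ _) (_ ∷ _ ∷ q ∷ _ ∷ r ∷ _) = positive-sum-nonzero p q r (cancellation on s)
  where
  cancellation : Identity scalar (λ s@(u₁ , u₂ , u₃ , u₄) →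
    det u₁ (δ₄ s) + det (δ₁ s) (δ₄ s) + det (δ₂ s) (δ₄ s)) λ _ → 0#
  cancellation = by-normalisation refl

f₁-f₃-compatible : ∀ s → Convex s → Convex (unstep f₁ s) → Convex (unstep f₃ s) →
  Convex (unstep f₁ (unstep f₃ s))
f₁-f₃-compatible s@(_ , u₂ , _ , u₄)
  (_ ∷ _ ∷ _ ∷ _ ∷ p₂₄ ∷ _) (p₁₂ ∷ _ ∷ p₁₄ ∷ _) (_ ∷ _ ∷ _ ∷ p₂₃ ∷ _ ∷ p₃₄ ∷ []) =
  p₁₂ ∷ positive-factorʳ p₂₄ (plücker-positive (δ₁ s) (δ₃ s) u₂ u₄ p₁₂ p₃₄ p₁₄ p₂₃) ∷
  p₁₄ ∷ p₂₃ ∷ p₂₄ ∷ p₃₄ ∷ []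

f₂-f₄-compatible : ∀ s → Convex s → Convex (unstep f₂ s) → Convex (unstep f₄ s) →
  Convex (unstep f₂ (unstep f₄ s))
f₂-f₄-compatible s@(u₁ , _ , u₃ , _)
  (_ ∷ p₁₃ ∷ _) (p₁₂ ∷ _ ∷ _ ∷ p₂₃ ∷ _) (_ ∷ _ ∷ p₁₄ ∷ _ ∷ _ ∷ p₃₄ ∷ []) =
  p₁₂ ∷ p₁₃ ∷ p₁₄ ∷ p₂₃ ∷
  positive-factorˡ p₁₃ (plücker-positive u₁ u₃ (δ₂ s) (δ₄ s) p₁₂ p₃₄ p₁₄ p₂₃) ∷ p₃₄ ∷ []

last-lift-unique : ∀ φ ψ s → Convex s → Convex (unstep φ s) → Convex (unstep ψ s) →
  φ ≡ ψ ⊎ Commute φ ψ × Convex (unstep φ (unstep ψ s))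
last-lift-unique f₁ f₁ s c a b = inj₁ refl
last-lift-unique f₁ f₂ s c a b = ⊥-elim (f₁-f₂-incompatible s c a b)
last-lift-unique f₁ f₃ s c a b = inj₂ (c13 , f₁-f₃-compatible s c a b)
last-lift-unique f₁ f₄ s c a b = ⊥-elim (f₁-f₄-incompatible s c a b)
last-lift-unique f₁ g⋆ s c a b = ⊥-elim (f₁-g⋆-incompatible s c a b)
last-lift-unique f₂ f₁ s c a b = ⊥-elim (f₁-f₂-incompatible s c b a)
last-lift-unique f₂ f₂ s c a b = inj₁ refl
last-lift-unique f₂ f₃ s c a b = ⊥-elim (f₂-f₃-incompatible s c a b)
last-lift-unique f₂ f₄ s c a b = inj₂ (c24 , f₂-f₄-compatible s c a b)
last-lift-unique f₂ g⋆ s c a b = ⊥-elim (f₂-g⋆-incompatible s c a b)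
last-lift-unique f₃ f₁ s c a b = inj₂ (c31 , f₁-f₃-compatible s c b a)
last-lift-unique f₃ f₂ s c a b = ⊥-elim (f₂-f₃-incompatible s c b a)
last-lift-unique f₃ f₃ s c a b = inj₁ refl
last-lift-unique f₃ f₄ s c a b = ⊥-elim (f₃-f₄-incompatible s c a b)
last-lift-unique f₃ g⋆ s c a b = ⊥-elim (f₃-g⋆-incompatible s c a b)
last-lift-unique f₄ f₁ s c a b = ⊥-elim (f₁-f₄-incompatible s c b a)
last-lift-unique f₄ f₂ s c a b = inj₂ (c42 , f₂-f₄-compatible s c b a)
last-lift-unique f₄ f₃ s c a b = ⊥-elim (f₃-f₄-incompatible s c b a)
last-lift-unique f₄ f₄ s c a b = inj₁ refl
last-lift-unique f₄ g⋆ s c a b = ⊥-elim (f₄-g⋆-incompatible s c a b)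
last-lift-unique g⋆ f₁ s c a b = ⊥-elim (f₁-g⋆-incompatible s c b a)
last-lift-unique g⋆ f₂ s c a b = ⊥-elim (f₂-g⋆-incompatible s c b a)
last-lift-unique g⋆ f₃ s c a b = ⊥-elim (f₃-g⋆-incompatible s c b a)
last-lift-unique g⋆ f₄ s c a b = ⊥-elim (f₄-g⋆-incompatible s c b a)
last-lift-unique g⋆ g⋆ s c a b = inj₁ refl

greekCrossQuadruple : Quadruple ℤ
greekCrossQuadruple = (1ℤ , 0ℤ) , (1ℤ , 1ℤ) , (0ℤ , 1ℤ) , (ℤ.-1ℤ , 1ℤ)

greekCross-no-predecessor : ∀ φ → ¬ Convex (unstep φ greekCrossQuadruple)
greekCross-no-predecessor f₁ = from-no (convex? (unstep f₁ greekCrossQuadruple))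
greekCross-no-predecessor f₂ = from-no (convex? (unstep f₂ greekCrossQuadruple))
greekCross-no-predecessor f₃ = from-no (convex? (unstep f₃ greekCrossQuadruple))
greekCross-no-predecessor f₄ = from-no (convex? (unstep f₄ greekCrossQuadruple))
greekCross-no-predecessor g⋆ = from-no (convex? (unstep g⋆ greekCrossQuadruple))

runFrom : Quadruple ℤ → List PLift → Quadruple ℤ
runFrom = foldl (λ s φ → step φ s)

runState : List PLift → Quadruple ℤ
runState = runFrom greekCrossQuadruple

runState-∷ʳ : ∀ p φ → runState (p ∷ʳ φ) ≡ step φ (runState p)
runState-∷ʳ p φ = foldl-∷ʳ (λ s φ → step φ s) greekCrossQuadruple φ p

unstep-runState-∷ʳ : ∀ p φ → unstep φ (runState (p ∷ʳ φ)) ≡ runState p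
unstep-runState-∷ʳ p φ = trans (cong (unstep φ) (runState-∷ʳ p φ)) (unstep-step φ on runState p)

runState-convex : ∀ p → Convex (runState p)
runState-convex p = runFrom-convex p (from-yes (convex? greekCrossQuadruple))
  where
  runFrom-convex : ∀ p {s} → Convex s → Convex (runFrom s p)
  runFrom-convex []      c = c
  runFrom-convex (φ ∷ p) {s} c = runFrom-convex p (step-convex φ s c)

predecessor-convex : ∀ p φ → Convex (unstep φ (runState (p ∷ʳ φ)))
predecessor-convex p φ = subst Convex (sym (unstep-runState-∷ʳ p φ)) (runState-convex p)

-- Uniqueness of the proto-descent

swap-sym : ∀ {p q} → Swap p q → Swap q p
swap-sym (here c13) = here c31
swap-sym (here c31) = here c13
swap-sym (here c24) = here c42
swap-sym (here c42) = here c24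
swap-sym (there sw) = there (swap-sym sw)

≈f-sym : ∀ {p q} → p ≈f q → q ≈f p
≈f-sym = Star.reverse swap-sym

≈f-∷ʳ : ∀ φ {p q} → p ≈f q → (p ∷ʳ φ) ≈f (q ∷ʳ φ)
≈f-∷ʳ φ = Star.gmap (_∷ʳ φ) swap-∷ʳ
  where
  swap-∷ʳ : ∀ {p q} → Swap p q → Swap (p ∷ʳ φ) (q ∷ʳ φ)
  swap-∷ʳ (here c)   = here c
  swap-∷ʳ (there sw) = there (swap-∷ʳ sw)

swap-last : ∀ {φ ψ} → Commute φ ψ → ∀ r → Swap (r ∷ʳ φ ∷ʳ ψ) (r ∷ʳ ψ ∷ʳ φ)
swap-last c []      = here c
swap-last c (x ∷ r) = there (swap-last c r)

runState-≈f : ∀ {p q} → p ≈f q → runState p ≡ runState q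
runState-≈f = runFrom-≈f greekCrossQuadruple
  where
  runFrom-swap : ∀ s {p q} → Swap p q → runFrom s p ≡ runFrom s q
  runFrom-swap s (here {xs = xs} c) = cong (λ t → runFrom t xs) (step-commute c s)
  runFrom-swap s (there {x} sw)     = runFrom-swap (step x s) sw

  runFrom-≈f : ∀ s {p q} → p ≈f q → runFrom s p ≡ runFrom s q
  runFrom-≈f s ε          = refl
  runFrom-≈f s (sw ◅ sws) = trans (runFrom-swap s sw) (runFrom-≈f s sws)

can-end-with : ∀ {p} → Reverse p → ∀ φ → Convex (unstep φ (runState p)) → ∃[ r ] p ≈f (r ∷ʳ φ)
can-end-with []              φ c = ⊥-elim (greekCross-no-predecessor φ c)
can-end-with (q ∶ q′ ∶ʳ ψ) φ c
  with last-lift-unique φ ψ (runState (q ∷ʳ ψ)) (runState-convex (q ∷ʳ ψ)) c (predecessor-convex q ψ)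
... | inj₁ refl = q , ε
... | inj₂ (φψ , c′)
  with r , q≈r∷ʳφ ← can-end-with q′ φ (subst (Convex ∘ unstep φ) (unstep-runState-∷ʳ q ψ) c′)
  = r ∷ʳ ψ , ≈f-∷ʳ ψ q≈r∷ʳφ ◅◅ swap-last φψ r ◅ ε

runState-injective : ∀ p q → runState p ≡ runState q → p ≈f q
runState-injective p = go (reverseView p)
  where
  open ≡-Reasoning
  go : ∀ {p} → Reverse p → ∀ q → runState p ≡ runState q → p ≈f q
  go [] q e with reverseView q
  ... | []            = ε
  ... | q′ ∶ _ ∶ʳ ψ =
    ⊥-elim (greekCross-no-predecessor ψ (subst (Convex ∘ unstep ψ) (sym e) (predecessor-convex q′ ψ)))
  go (p ∶ p′ ∶ʳ φ) q e
    with r , q≈r∷ʳφ ← can-end-with (reverseView q) φ (subst (Convex ∘ unstep φ) e (predecessor-convex p φ))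
    = ≈f-∷ʳ φ (go p′ r (step-injective φ same-step)) ◅◅ ≈f-sym q≈r∷ʳφ
    where
    same-step : step φ (runState p) ≡ step φ (runState r)
    same-step = begin
      step φ (runState p)  ≡⟨ runState-∷ʳ p φ ⟨
      runState (p ∷ʳ φ)    ≡⟨ e ⟩
      runState q           ≡⟨ runState-≈f q≈r∷ʳφ ⟩
      runState (r ∷ʳ φ)    ≡⟨ runState-∷ʳ r φ ⟩
      step φ (runState r)  ∎

-- Spans of descendant chains

letter : Letter → Vector ℤ
letter R = 1ℤ , 0ℤ
letter L = ℤ.-1ℤ , 0ℤ
letter U = 0ℤ , 1ℤ
letter D = 0ℤ , ℤ.-1ℤ

letter-rev : ∀ c → letter (rev c) ≡ ⊖ letter c
letter-rev R = refl
letter-rev L = refl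
letter-rev U = refl
letter-rev D = refl

span-∷ : ∀ c w → span (c ∷ w) ≡ letter c ⊕ span w
span-∷ R w = ×-≡,≡→≡ (ℤ.+-comm (proj₁ (span w)) 1ℤ , sym (ℤ.+-identityˡ (proj₂ (span w))))
span-∷ L w = ×-≡,≡→≡ (ℤ.+-comm (proj₁ (span w)) ℤ.-1ℤ , sym (ℤ.+-identityˡ (proj₂ (span w))))
span-∷ U w = ×-≡,≡→≡ (sym (ℤ.+-identityˡ (proj₁ (span w))) , ℤ.+-comm (proj₂ (span w)) 1ℤ)
span-∷ D w = ×-≡,≡→≡ (sym (ℤ.+-identityˡ (proj₁ (span w))) , ℤ.+-comm (proj₂ (span w)) ℤ.-1ℤ)

span-++ : ∀ u v → span (u ++ v) ≡ span u ⊕ span v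
span-++ [] v = sym (⊕-identityˡ on (span v , span v , span v , span v))
  where
  ⊕-identityˡ : Identity plane (λ (u , _ , _ , _) → (0# , 0#) ⊕ u) (λ (u , _ , _ , _) → u)
  ⊕-identityˡ = by-normalisation refl
span-++ (c ∷ u) v = begin
  span (c ∷ u ++ v)                  ≡⟨ span-∷ c (u ++ v) ⟩
  letter c ⊕ span (u ++ v)           ≡⟨ cong (letter c ⊕_) (span-++ u v) ⟩
  letter c ⊕ (span u ⊕ span v)       ≡⟨ ⊕-assoc on (letter c , span u , span v , span v) ⟨
  letter c ⊕ span u ⊕ span v         ≡⟨ cong (_⊕ span v) (span-∷ c u) ⟨
  span (c ∷ u) ⊕ span v              ∎
  where
  open ≡-Reasoning
  ⊕-assoc : Identity plane (λ (u , v , w , _) → u ⊕ v ⊕ w) (λ (u , v , w , _) → u ⊕ (v ⊕ w))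
  ⊕-assoc = by-normalisation refl

span-inv : ∀ w → span (inv w) ≡ ⊖ span w
span-inv []      = refl
span-inv (c ∷ w) = begin
  span (inv (c ∷ w))                      ≡⟨ cong span (unfold-reverse (rev c) (map rev w)) ⟩
  span (inv w ++ rev c ∷ [])              ≡⟨ span-++ (inv w) (rev c ∷ []) ⟩
  span (inv w) ⊕ span (rev c ∷ [])        ≡⟨ cong₂ _⊕_ (span-inv w) (span-∷ (rev c) []) ⟩
  ⊖ span w ⊕ (letter (rev c) ⊕ span [])   ≡⟨ cong (λ v → ⊖ span w ⊕ (v ⊕ span [])) (letter-rev c) ⟩
  ⊖ span w ⊕ (⊖ letter c ⊕ span [])       ≡⟨ rearrange on (span w , letter c , span w , span w) ⟩
  ⊖ (letter c ⊕ span w)                   ≡⟨ cong ⊖_ (span-∷ c w) ⟨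
  ⊖ span (c ∷ w)                          ∎
  where
  open ≡-Reasoning
  rearrange : Identity plane (λ (u , v , _ , _) → ⊖ u ⊕ (⊖ v ⊕ (0# , 0#))) (λ (u , v , _ , _) → ⊖ (v ⊕ u))
  rearrange = by-normalisation refl

-- apply, with concatenation and inversion of words abstracted so that it can be pushed through span.
module _ {X : Set} (_·_ : X → X → X) (_⁻¹ : X → X) where

  threeSum fiveSum : Vec X 8 → Fin 8 → X
  threeSum v j = lookup v (sh j 3) · (lookup v (sh j 4) · lookup v (sh j 5))
  fiveSum v j =
    lookup v (sh j 6) · (lookup v (sh j 7) · (lookup v (sh j 0) · (lookup v (sh j 1) · lookup v (sh j 2))))

  liftAt : Lift → Vec X 8 → Fin 8 → X
  liftAt (f i) v j = if does ((toℕ j % 4) ≟ toℕ i) then threeSum v j ⁻¹ else lookup v j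
  liftAt godd  v j = if paperOdd j then fiveSum v j ⁻¹ else threeSum v j
  liftAt geven v j = if paperOdd j then threeSum v j else fiveSum v j ⁻¹

  lift : Lift → Vec X 8 → Vec X 8
  lift φ v = tabulate (liftAt φ v)

apply-lift : ∀ φ C → apply φ C ≡ lift _++_ inv φ C
apply-lift (f i) C = refl
apply-lift godd  C = refl
apply-lift geven C = refl

lift-homomorphism : ∀ {X Y : Set} {_·_ : X → X → X} {_⁻¹ : X → X} {_∙_ : Y → Y → Y} {_⁻¹′ : Y → Y}
  (h : X → Y) → (∀ a b → h (a · b) ≡ h a ∙ h b) → (∀ a → h (a ⁻¹) ≡ h a ⁻¹′) →
  ∀ φ v → Vec.map h (lift _·_ _⁻¹ φ v) ≡ lift _∙_ _⁻¹′ φ (Vec.map h v)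
lift-homomorphism {_·_ = _·_} {_⁻¹} {_∙_} {_⁻¹′} h h-· h-⁻¹ φ v =
  trans (sym (tabulate-∘ h (liftAt _·_ _⁻¹ φ v))) (tabulate-cong (pointwise φ))
  where
  h-lookup : ∀ k → h (lookup v k) ≡ lookup (Vec.map h v) k
  h-lookup k = sym (lookup-map k h v)

  h-three : ∀ j → h (threeSum _·_ _⁻¹ v j) ≡ threeSum _∙_ _⁻¹′ (Vec.map h v) j
  h-three j = trans (h-· _ _) (cong₂ _∙_ (h-lookup _) (trans (h-· _ _) (cong₂ _∙_ (h-lookup _) (h-lookup _))))

  h-five : ∀ j → h (fiveSum _·_ _⁻¹ v j) ≡ fiveSum _∙_ _⁻¹′ (Vec.map h v) j
  h-five j = trans (h-· _ _) (cong₂ _∙_ (h-lookup _) (trans (h-· _ _) (cong₂ _∙_ (h-lookup _)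
    (trans (h-· _ _) (cong₂ _∙_ (h-lookup _) (trans (h-· _ _) (cong₂ _∙_ (h-lookup _) (h-lookup _))))))))

  h-if : ∀ b {x y x′ y′} → h x ≡ x′ → h y ≡ y′ → h (if b then x else y) ≡ (if b then x′ else y′)
  h-if true  hx hy = hx
  h-if false hx hy = hy

  pointwise : ∀ φ j → h (liftAt _·_ _⁻¹ φ v j) ≡ liftAt _∙_ _⁻¹′ φ (Vec.map h v) j
  pointwise (f i) j = h-if (does ((toℕ j % 4) ≟ toℕ i)) (trans (h-⁻¹ _) (cong _⁻¹′ (h-three j))) (h-lookup j)
  pointwise godd  j = h-if (paperOdd j) (trans (h-⁻¹ _) (cong _⁻¹′ (h-five j))) (h-three j)
  pointwise geven j = h-if (paperOdd j) (h-three j) (trans (h-⁻¹ _) (cong _⁻¹′ (h-five j)))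

spans : Chain → Vec (Vector ℤ) 8
spans = Vec.map span

span-lookup : ∀ C k → span (lookup C k) ≡ lookup (spans C) k
span-lookup C k = sym (lookup-map k span C)

spans-apply : ∀ φ C → spans (apply φ C) ≡ lift _⊕_ ⊖_ φ (spans C)
spans-apply φ C = trans (cong spans (apply-lift φ C)) (lift-homomorphism span span-++ span-inv φ C)

module _ {A : Set} ⦃ _ : RingOperations A ⦄ where

  extend : Quadruple A → Vec (Vector A) 8
  extend (u₁ , u₂ , u₃ , u₄) = u₁ ∷ u₂ ∷ u₃ ∷ u₄ ∷ ⊖ u₁ ∷ ⊖ u₂ ∷ ⊖ u₃ ∷ ⊖ u₄ ∷ []

lift-extend : ∀ φ →
  Identity (vector 8 plane) (λ s → lift _⊕_ ⊖_ φ (extend s)) (λ s → extend (step (protoSym φ) s))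
lift-extend (f zero)                   = by-normalisation refl
lift-extend (f (suc zero))             = by-normalisation refl
lift-extend (f (suc (suc zero)))       = by-normalisation refl
lift-extend (f (suc (suc (suc zero)))) = by-normalisation refl
lift-extend godd                       = by-normalisation refl
lift-extend geven                      = by-normalisation refl

spans-run : ∀ d → spans (run d) ≡ extend (runState (proto d))
spans-run d = spans-descent d refl
  where
  spans-descent : ∀ d {C s} → spans C ≡ extend s →
    spans (foldl (λ C φ → apply φ C) C d) ≡ extend (runFrom s (proto d))
  spans-descent []      e = e
  spans-descent (φ ∷ d) {C} {s} e = spans-descent d (begin
    spans (apply φ C)               ≡⟨ spans-apply φ C ⟩
    lift _⊕_ ⊖_ φ (spans C)         ≡⟨ cong (lift _⊕_ ⊖_ φ) e ⟩
    lift _⊕_ ⊖_ φ (extend s)        ≡⟨ lift-extend φ on s ⟩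
    extend (step (protoSym φ) s)    ∎)
    where open ≡-Reasoning

-- Neighbourhood vectors

module _ {A : Set} ⦃ _ : RingOperations A ⦄ where

  neighbourSums double alternatingSums : Quadruple A → Quadruple A
  neighbourSums (u₁ , u₂ , u₃ , u₄) = u₁ ⊕ u₂ , u₂ ⊕ u₃ , u₃ ⊕ u₄ , u₄ ⊖ u₁
  double (u₁ , u₂ , u₃ , u₄) = u₁ ⊕ u₁ , u₂ ⊕ u₂ , u₃ ⊕ u₃ , u₄ ⊕ u₄
  alternatingSums (s₁ , s₂ , s₃ , s₄) =
    s₁ ⊖ s₂ ⊕ s₃ ⊖ s₄ , s₁ ⊕ s₂ ⊖ s₃ ⊕ s₄ , s₂ ⊕ s₃ ⊖ s₁ ⊖ s₄ , s₁ ⊖ s₂ ⊕ s₃ ⊕ s₄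

alternatingSums-neighbourSums : Identity quadruple (λ s → alternatingSums (neighbourSums s)) double
alternatingSums-neighbourSums = by-normalisation refl

double-injective : ∀ {s t : Quadruple ℤ} → double s ≡ double t → s ≡ t
double-injective e =
  let e₁ , e′ = ×-≡,≡←≡ e
      e₂ , e″ = ×-≡,≡←≡ e′
      e₃ , e₄ = ×-≡,≡←≡ e″
  in  cong₂ _,_ (halve-vector e₁) (cong₂ _,_ (halve-vector e₂) (cong₂ _,_ (halve-vector e₃) (halve-vector e₄)))
  where
  twice : ∀ z → + 2 ℤ.* z ≡ z ℤ.+ z
  twice z = trans (ℤ.*-distribʳ-+ z 1ℤ 1ℤ) (cong₂ ℤ._+_ (ℤ.*-identityˡ z) (ℤ.*-identityˡ z))

  halve : ∀ {x y : ℤ} → x ℤ.+ x ≡ y ℤ.+ y → x ≡ y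
  halve {x} {y} e = ℤ.*-cancelˡ-≡ (+ 2) x y (trans (twice x) (trans e (sym (twice y))))

  halve-vector : ∀ {u v : Vector ℤ} → u ⊕ u ≡ v ⊕ v → u ≡ v
  halve-vector e = let ex , ey = ×-≡,≡←≡ e in ×-≡,≡→≡ (halve ex , halve ey)

neighbourSums-injective : ∀ {s t : Quadruple ℤ} → neighbourSums s ≡ neighbourSums t → s ≡ t
neighbourSums-injective {s} {t} e = double-injective (begin
  double s                            ≡⟨ alternatingSums-neighbourSums on s ⟨
  alternatingSums (neighbourSums s)   ≡⟨ cong alternatingSums e ⟩
  alternatingSums (neighbourSums t)   ≡⟨ alternatingSums-neighbourSums on t ⟩
  double t                            ∎)
  where open ≡-Reasoning

firstFour : ∀ {X : Set} → (Fin 8 → X) → X × X × X × X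
firstFour g = g (# 0) , g (# 1) , g (# 2) , g (# 3)

firstFour-cong : ∀ {X : Set} {g h : Fin 8 → X} → (∀ i → g i ≡ h i) → firstFour g ≡ firstFour h
firstFour-cong e = cong₂ _,_ (e _) (cong₂ _,_ (e _) (cong₂ _,_ (e _) (e _)))

nv-spans : ∀ C i → nv C i ≡ lookup (spans C) (sh i 0) ⊕ lookup (spans C) (sh i 1)
nv-spans C i = trans (span-++ (at C i 0) (at C i 1)) (cong₂ _⊕_ (span-lookup C _) (span-lookup C _))

neighbourhoods-run : ∀ d → firstFour (nv (run d)) ≡ neighbourSums (runState (proto d))
neighbourhoods-run d = firstFour-cong λ i →
  trans (nv-spans (run d) i) (cong (λ v → lookup v (sh i 0) ⊕ lookup v (sh i 1)) (spans-run d))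

proposition2 : (U U' : Chain) (d d' : List Lift)
    → IsDescent d U → IsDescent d' U'
    → (∀ (i : Fin 8) → nv U i ≡ nv U' i)
    → proto d ≈f proto d'
proposition2 _ _ d d′ refl refl same-nv =
  runState-injective (proto d) (proto d′) (neighbourSums-injective (begin
    neighbourSums (runState (proto d))    ≡⟨ neighbourhoods-run d ⟨
    firstFour (nv (run d))                ≡⟨ firstFour-cong same-nv ⟩
    firstFour (nv (run d′))               ≡⟨ neighbourhoods-run d′ ⟩
    neighbourSums (runState (proto d′))   ∎))
  where open ≡-Reasoning
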